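{- Let $m,n$ be positive integers and $G=G_{m,n}$ the $m\times n$ grid. A set $S\subseteq V(G)$ is convex if and only if $S$ is boxed.
   Context: $G_{m,n}$ has vertex set $\{(i,j):1\le i\le m,1\le j\le n\}$ with $(i,j)$ adjacent to $(i,j+1)$ and to $(i+1,j)$ whenever these exist. A set $S\subseteq V(G)$ is boxed if every connected component of the induced subgraph $G[S]$ is itself a grid, i.e. its vertex set is of the form $\{(i,j): a\le i\le b,\ c\le j\le d\}$ for some $a\le b$, $c\le d$. A cycle is a closed walk $(v_1,\dots,v_q,v_1)$ with at least one edge in which the only repeated vertex is $v_1$. For $S\subseteq V(G)$, $I_{cc}(S)=S\cup\{v\in V(G): \text{there is a cycle } C \text{ of } G \text{ with } V(C)\setminus S=\{v\}\}$, and $S$ is convex if $I_{cc}(S)=S$. -}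

module Defs where

open import Data.Nat using (ℕ; suc; _≤_)
open import Data.Fin using (Fin; toℕ)
open import Data.Bool using (Bool; true; false)
open import Data.Product using (Σ; _×_; ∃-syntax; _,_)
open import Data.Sum using (_⊎_)
open import Data.List using (List; _∷_; []; _++_; length)
open import Data.List.Membership.Propositional using (_∈_)
open import Data.List.Relation.Unary.Linked using (Linked)
open import Data.List.Relation.Unary.Unique.Propositional using (Unique)
open import Relation.Binary.PropositionalEquality using (_≡_)
open import Function.Bundles using (_⇔_)

-- Vertices of the grid G_{m,n}: (i , j) with i : Fin m (row), j : Fin n (column)
-- (0-based indices; (i , j) corresponds to the paper's (i+1 , j+1)).
V : ℕ → ℕ → Set
V m n = Fin m × Fin n

Adj : ∀ {m n} → V m n → V m n → Set
Adj (i , j) (i' , j') =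
  (toℕ i ≡ toℕ i' × (suc (toℕ j) ≡ toℕ j' ⊎ suc (toℕ j') ≡ toℕ j))
  ⊎ (toℕ j ≡ toℕ j' × (suc (toℕ i) ≡ toℕ i' ⊎ suc (toℕ i') ≡ toℕ i))

-- A cycle (v₁ , … , v_q , v₁): a list v₁ ∷ rest of pairwise distinct vertices,
-- q ≥ 3, such that the closed walk (v₁ ∷ rest) ++ [ v₁ ] follows edges.
record Cycle (m n : ℕ) : Set where
  constructor mkCycle
  field
    start    : V m n
    rest     : List (V m n)
    long     : 2 ≤ length rest
    distinct : Unique (start ∷ rest)
    walk     : Linked Adj ((start ∷ rest) ++ (start ∷ []))

verts : ∀ {m n} → Cycle m n → List (V m n)
verts C = Cycle.start C ∷ Cycle.rest C

Subset : ℕ → ℕ → Set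
Subset m n = V m n → Bool

InIcc : ∀ {m n} → Subset m n → V m n → Set
InIcc {m} {n} S v =
  S v ≡ true
  ⊎ Σ (Cycle m n) (λ C →
      (v ∈ verts C) × (S v ≡ false)
      × (∀ u → u ∈ verts C → S u ≡ false → u ≡ v))

Convex : ∀ {m n} → Subset m n → Set
Convex S = ∀ v → InIcc S v ⇔ (S v ≡ true)

data Reach {m n} (S : Subset m n) : V m n → V m n → Set where
  here : ∀ {u} → S u ≡ true → Reach S u u
  step : ∀ {u w v} → Reach S u w → Adj w v → S v ≡ true → Reach S u v

InRect : ∀ {m n} → ℕ → ℕ → ℕ → ℕ → V m n → Set
InRect a b c d (i , j) = (a ≤ toℕ i × toℕ i ≤ b) × (c ≤ toℕ j × toℕ j ≤ d)

Boxed : ∀ {m n} → Subset m n → Set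
Boxed S = ∀ v → S v ≡ true →
  ∃[ a ] ∃[ b ] ∃[ c ] ∃[ d ]
    (a ≤ b × c ≤ d × (∀ u → Reach S v u ⇔ InRect a b c d u))

-- A 4-cycle of the grid is a unit square, so a convex set contains the fourth corner of every
-- unit square of which it contains three. For such an S, the component of v is the box
-- [a,b] × [c,d], where [c,d] is the maximal run of S through v in its row and [a,b] the maximal
-- run of rows through v containing all of [c,d]: on a line adjacent and parallel to a side of
-- the box, square-closure makes membership in S constant, so a vertex of S adjacent to the box
-- would contradict one of the two maximalities.
-- Conversely, if v ∉ S lies on a cycle all of whose other vertices are in S, its two neighbours
-- on the cycle are distinct and joined in G[S], hence lie in one box; but a vertex outside a box
-- has at most one neighbour in it.
module Submission where

open import Defs
open import Data.Bool using (Bool; true; false)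
open import Data.Bool.Properties using (¬-not) renaming (_≟_ to _≟ᵇ_)
open import Data.Fin using (toℕ; fromℕ<)
open import Data.Fin.Properties using (toℕ<n; toℕ-fromℕ<; fromℕ<-toℕ; toℕ-injective)
open import Data.List using ([]; _∷_; _++_; [_]; length)
open import Data.List.Properties using (++-assoc)
open import Data.List.Membership.Propositional using (_∈_)
open import Data.List.Membership.Propositional.Properties using (∈-∃++)
open import Data.List.Relation.Unary.All as All using (All; []; _∷_)
open import Data.List.Relation.Unary.AllPairs using ([]; _∷_)
open import Data.List.Relation.Unary.Any using (here; there)
open import Data.List.Relation.Unary.Linked using (Linked; [-]; _∷_)
open import Data.List.Relation.Unary.Unique.Propositional using (Unique)
open import Data.List.Relation.Binary.Permutation.Propositional using (_↭_; ↭-refl; ↭-sym; ↭⇒↭ₛ)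
open import Data.List.Relation.Binary.Permutation.Propositional.Properties using (++-comm; ↭-length; ∈-resp-↭)
open import Data.List.Relation.Binary.Permutation.Setoid.Properties using (Unique-resp-↭)
open import Data.Nat using (ℕ; zero; suc; _+_; _≤_; _<_; z≤n; s≤s; s≤s⁻¹; _<?_; _≤?_)
open import Data.Nat.Properties
  using (≤-refl; ≤-trans; ≤-antisym; ≤-total; <⇒≤; n≤1+n; m≤n⇒m≤1+n; m≤n⇒m<n∨m≡n;
         m≤m+n; +-suc; 1+n≢n; <-irrefl; suc-injective; allUpTo?)
open import Data.Product using (Σ-syntax; ∃-syntax; ∃₂; _×_; _,_; proj₁; proj₂; swap; map₁)
open import Data.Sum using (_⊎_; inj₁; inj₂)
open import Function using (_∘_)
open import Function.Bundles using (_⇔_; mk⇔; Equivalence)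
open import Function.Properties.Equivalence using () renaming (trans to ⇔-trans)
open import Relation.Binary.PropositionalEquality
  using (_≡_; _≢_; refl; sym; trans; cong; cong₂; subst; setoid)
open import Relation.Nullary using (¬_; Dec; yes; no; contradiction)
open import Relation.Nullary.Decidable using (map′; _→-dec_)
open import Relation.Unary using (Decidable)

infix 4 _~_ _∈[_,_]

_~_ : ℕ → ℕ → Set
t ~ t′ = suc t ≡ t′ ⊎ suc t′ ≡ t

~-sym : ∀ {t t′} → t ~ t′ → t′ ~ t
~-sym (inj₁ e) = inj₂ e
~-sym (inj₂ e) = inj₁ e

~⇒≢ : ∀ {t t′} → t ~ t′ → t ≢ t′
~⇒≢ (inj₁ e) refl = 1+n≢n e
~⇒≢ (inj₂ e) refl = 1+n≢n e

_∈[_,_] : ℕ → ℕ → ℕ → Set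
t ∈[ lo , hi ] = lo ≤ t × t ≤ hi

interval-ind : ∀ {lo hi} (A : ℕ → Set) → A lo →
  (∀ {t} → lo ≤ t → suc t ≤ hi → A t → A (suc t)) →
  ∀ {t} → t ∈[ lo , hi ] → A t
interval-ind A base next (lo≤t , _) with m≤n⇒m<n∨m≡n lo≤t
interval-ind A base next (_ , _)    | inj₂ refl = base
interval-ind A base next {suc t} (_ , t<hi) | inj₁ (s≤s lo≤t) =
  next lo≤t t<hi (interval-ind A base next (lo≤t , <⇒≤ t<hi))

constant-on : ∀ {A : Set} {lo hi} (f : ℕ → A) →
  (∀ {t} → lo ≤ t → suc t ≤ hi → f t ≡ f (suc t)) →
  ∀ {t t′} → t ∈[ lo , hi ] → t′ ∈[ lo , hi ] → f t ≡ f t′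
constant-on {lo = lo} f rung t∈ t′∈ = trans (sym (from-lo t∈)) (from-lo t′∈)
  where
  from-lo : ∀ {t} → t ∈[ _ , _ ] → f lo ≡ f t
  from-lo = interval-ind (λ t → f lo ≡ f t) refl (λ lo≤t t<hi e → trans e (rung lo≤t t<hi))

interval-neighbour-unique : ∀ {lo hi t t′ w} → t ∈[ lo , hi ] → t′ ∈[ lo , hi ] →
  ¬ w ∈[ lo , hi ] → t ~ w → t′ ~ w → t ≡ t′
interval-neighbour-unique _ _ _ (inj₁ e) (inj₁ e′) = suc-injective (trans e (sym e′))
interval-neighbour-unique (lo≤t , _) (_ , t′≤hi) w∉ (inj₁ refl) (inj₂ refl) =
  contradiction (m≤n⇒m≤1+n lo≤t , ≤-trans (n≤1+n _) t′≤hi) w∉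
interval-neighbour-unique (_ , t≤hi) (lo≤t′ , _) w∉ (inj₂ refl) (inj₁ refl) =
  contradiction (m≤n⇒m≤1+n lo≤t′ , ≤-trans (n≤1+n _) t≤hi) w∉
interval-neighbour-unique _ _ _ (inj₂ e) (inj₂ e′) = trans (sym e) e′

all-in-interval? : ∀ {Q : ℕ → Set} → Decidable Q → ∀ lo hi → Dec (∀ {t} → t ∈[ lo , hi ] → Q t)
all-in-interval? Q? lo hi =
  map′ (λ all {t} (lo≤t , t≤hi) → all {t} (s≤s t≤hi) lo≤t)
       (λ all {t} t<1+hi lo≤t → all {t} (lo≤t , s≤s⁻¹ t<1+hi))
       (allUpTo? (λ t → lo ≤? t →-dec Q? t) (suc hi))

record MaximalInterval (Q : ℕ → Set) (k : ℕ) : Set where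
  field
    lo hi  : ℕ
    k∈     : k ∈[ lo , hi ]
    inside : ∀ {t} → t ∈[ lo , hi ] → Q t
    closed : ∀ {t t′} → t ∈[ lo , hi ] → t ~ t′ → Q t′ → t′ ∈[ lo , hi ]

module _ {Q : ℕ → Set} (Q? : Decidable Q) where

  extend-down : ∀ k → Q k →
    ∃[ lo ] lo ≤ k × (∀ {t} → t ∈[ lo , k ] → Q t) × (∀ {t} → suc t ≡ lo → ¬ Q t)
  extend-down zero q = zero , z≤n , (λ { (z≤n , z≤n) → q }) , λ ()
  extend-down (suc k) q with Q? k
  ... | no ¬q = suc k , ≤-refl , (λ (l , u) → subst Q (≤-antisym l u) q) , λ { refl → ¬q }
  ... | yes q′ with extend-down k q′
  ...   | lo , lo≤k , all , edge = lo , m≤n⇒m≤1+n lo≤k , all′ , edge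
    where
    all′ : ∀ {t} → t ∈[ lo , suc k ] → Q t
    all′ (l , u) with m≤n⇒m<n∨m≡n u
    ... | inj₁ t<1+k = all (l , s≤s⁻¹ t<1+k)
    ... | inj₂ refl  = q

  extend-up : ∀ {B} → (∀ {t} → Q t → t < B) → ∀ k → Q k →
    ∃[ hi ] k ≤ hi × (∀ {t} → t ∈[ k , hi ] → Q t) × ¬ Q (suc hi)
  extend-up {B} bounded k = go B k (m≤m+n B k)
    where
    go : ∀ fuel k → B ≤ fuel + k → Q k →
      ∃[ hi ] k ≤ hi × (∀ {t} → t ∈[ k , hi ] → Q t) × ¬ Q (suc hi)
    go zero k B≤k q = contradiction (≤-trans (bounded q) B≤k) (<-irrefl refl)
    go (suc fuel) k B≤ q with Q? (suc k)
    ... | no ¬q′ = k , ≤-refl , (λ (l , u) → subst Q (≤-antisym l u) q) , ¬q′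
    ... | yes q′ with go fuel (suc k) (subst (B ≤_) (sym (+-suc fuel k)) B≤) q′
    ...   | hi , k<hi , all , edge = hi , <⇒≤ k<hi , all′ , edge
      where
      all′ : ∀ {t} → t ∈[ k , hi ] → Q t
      all′ (l , u) with m≤n⇒m<n∨m≡n l
      ... | inj₁ k<t = all (k<t , u)
      ... | inj₂ refl = q

  maximal-interval : ∀ {B k} → (∀ {t} → Q t → t < B) → Q k → MaximalInterval Q k
  maximal-interval {k = k} bounded q with extend-down k q | extend-up bounded k q
  ... | lo , lo≤k , below , below-edge | hi , k≤hi , above , above-edge = record
    { lo = lo ; hi = hi ; k∈ = lo≤k , k≤hi ; inside = inside ; closed = closed }
    where
    inside : ∀ {t} → t ∈[ lo , hi ] → Q t
    inside {t} (l , u) with ≤-total t k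
    ... | inj₁ t≤k = below (l , t≤k)
    ... | inj₂ k≤t = above (k≤t , u)
    closed : ∀ {t t′} → t ∈[ lo , hi ] → t ~ t′ → Q t′ → t′ ∈[ lo , hi ]
    closed (l , u) (inj₁ refl) q′ with m≤n⇒m<n∨m≡n u
    ... | inj₁ t<hi = m≤n⇒m≤1+n l , t<hi
    ... | inj₂ refl = contradiction q′ above-edge
    closed (l , u) (inj₂ refl) q′ with m≤n⇒m<n∨m≡n l
    ... | inj₁ lo<t = s≤s⁻¹ lo<t , ≤-trans (n≤1+n _) u
    ... | inj₂ lo≡t = contradiction q′ (below-edge (sym lo≡t))

Point : Set
Point = ℕ × ℕ

Adjacent : Point → Point → Set
Adjacent (r , t) (r′ , t′) = (r ≡ r′ × t ~ t′) ⊎ (t ≡ t′ × r ~ r′)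

adjacent-sym : ∀ {p q} → Adjacent p q → Adjacent q p
adjacent-sym (inj₁ (refl , t~t′)) = inj₁ (refl , ~-sym t~t′)
adjacent-sym (inj₂ (refl , r~r′)) = inj₂ (refl , ~-sym r~r′)

adjacent⇒≢ : ∀ {p q} → Adjacent p q → p ≢ q
adjacent⇒≢ (inj₁ (_ , t~t′)) refl = ~⇒≢ t~t′ refl
adjacent⇒≢ (inj₂ (_ , r~r′)) refl = ~⇒≢ r~r′ refl

InBox : ℕ → ℕ → ℕ → ℕ → Point → Set
InBox a b c d (r , t) = r ∈[ a , b ] × t ∈[ c , d ]

data Reach² (P : Point → Bool) : Point → Point → Set where
  here : ∀ {p} → P p ≡ true → Reach² P p p
  step : ∀ {p q r} → Reach² P p q → Adjacent q r → P r ≡ true → Reach² P p r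

module _ {P : Point → Bool} where

  reach²-target : ∀ {p q} → Reach² P p q → P q ≡ true
  reach²-target (here Pp)     = Pp
  reach²-target (step _ _ Pq) = Pq

  reach²-trans : ∀ {p q r} → Reach² P p q → Reach² P q r → Reach² P p r
  reach²-trans p⇝q (here _)            = p⇝q
  reach²-trans p⇝q (step q⇝r′ r′~r Pr) = step (reach²-trans p⇝q q⇝r′) r′~r Pr

  reach²-sym : ∀ {p q} → Reach² P p q → Reach² P q p
  reach²-sym (here Pp)          = here Pp
  reach²-sym (step p⇝q′ q′~q Pq) =
    reach²-trans (step (here Pq) (adjacent-sym q′~q) (reach²-target p⇝q′)) (reach²-sym p⇝q′)

  segment-connected : ∀ {lo hi} (f : ℕ → Point) → (∀ t → Adjacent (f t) (f (suc t))) →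
    (∀ {t} → t ∈[ lo , hi ] → P (f t) ≡ true) →
    ∀ {t t′} → t ∈[ lo , hi ] → t′ ∈[ lo , hi ] → Reach² P (f t) (f t′)
  segment-connected {lo} f f~ P-on t∈@(lo≤t , t≤hi) t′∈ =
    reach²-trans (reach²-sym (from-lo t∈)) (from-lo t′∈)
    where
    from-lo : ∀ {t} → t ∈[ _ , _ ] → Reach² P (f lo) (f t)
    from-lo = interval-ind (λ t → Reach² P (f lo) (f t)) (here (P-on (≤-refl , ≤-trans lo≤t t≤hi)))
      (λ {t} lo≤t t<hi lo⇝t → step lo⇝t (f~ t) (P-on (m≤n⇒m≤1+n lo≤t , t<hi)))

  box-connected : ∀ {a b c d p q} → (∀ {u} → InBox a b c d u → P u ≡ true) →
    InBox a b c d p → InBox a b c d q → Reach² P p q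
  box-connected {p = r , t} {r′ , t′} box⊆P (r∈ , t∈) (r′∈ , t′∈) =
    reach²-trans along-row along-column
    where
    along-row : Reach² P (r , t) (r , t′)
    along-row =
      segment-connected (r ,_) (λ _ → inj₁ (refl , inj₁ refl)) (λ s∈ → box⊆P (r∈ , s∈)) t∈ t′∈
    along-column : Reach² P (r , t′) (r′ , t′)
    along-column =
      segment-connected (_, t′) (λ _ → inj₂ (refl , inj₁ refl)) (λ s∈ → box⊆P (s∈ , t′∈)) r∈ r′∈

box-neighbour-unique : ∀ {a b c d p q w} → InBox a b c d p → InBox a b c d q → ¬ InBox a b c d w →
  Adjacent p w → Adjacent q w → p ≡ q
box-neighbour-unique (r∈ , t∈) (_ , t′∈) w∉ (inj₁ (refl , t~)) (inj₁ (refl , t′~)) =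
  cong (_ ,_) (interval-neighbour-unique t∈ t′∈ (λ s∈ → w∉ (r∈ , s∈)) t~ t′~)
box-neighbour-unique (r∈ , _) (_ , t′∈) w∉ (inj₁ (refl , _)) (inj₂ (refl , _)) =
  contradiction (r∈ , t′∈) w∉
box-neighbour-unique (_ , t∈) (r′∈ , _) w∉ (inj₂ (refl , _)) (inj₁ (refl , _)) =
  contradiction (r′∈ , t∈) w∉
box-neighbour-unique (r∈ , t∈) (r′∈ , _) w∉ (inj₂ (refl , r~)) (inj₂ (refl , r′~)) =
  cong (_, _) (interval-neighbour-unique r∈ r′∈ (λ s∈ → w∉ (s∈ , t∈)) r~ r′~)

-- (r , t), (r , t′), (r′ , t′), (r′ , t) are the corners of a unit square.
SquareClosed : (Point → Bool) → Set
SquareClosed P = ∀ {r r′ t t′} → r ~ r′ → t ~ t′ →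
  P (r , t′) ≡ true → P (r , t) ≡ true → P (r′ , t) ≡ true → P (r′ , t′) ≡ true

transpose-closed : ∀ {P} → SquareClosed P → SquareClosed (P ∘ swap)
transpose-closed closed r~r′ t~t′ Prt′ Prt Pr′t = closed t~t′ r~r′ Pr′t Prt Prt′

Bounded : ℕ → ℕ → (Point → Bool) → Set
Bounded M N P = ∀ {r t} → P (r , t) ≡ true → r < M × t < N

bool-ext : ∀ {x y : Bool} → (x ≡ true → y ≡ true) → (y ≡ true → x ≡ true) → x ≡ y
bool-ext {false} {false} _ _ = refl
bool-ext {false} {true}  _ y⇒x = y⇒x refl
bool-ext {true}  {false} x⇒y _ = sym (x⇒y refl)
bool-ext {true}  {true}  _ _ = refl

row-constant : ∀ {P} → SquareClosed P → ∀ {r r′ c d} → r ~ r′ →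
  (∀ {t} → t ∈[ c , d ] → P (r , t) ≡ true) →
  ∀ {t t′} → t ∈[ c , d ] → t′ ∈[ c , d ] → P (r′ , t) ≡ P (r′ , t′)
row-constant {P} closed {r} {r′} r~r′ full = constant-on (λ t → P (r′ , t)) rung
  where
  rung : ∀ {t} → _ ≤ t → suc t ≤ _ → P (r′ , t) ≡ P (r′ , suc t)
  rung {t} c≤t t<d = bool-ext (closed r~r′ (inj₁ refl) full-at-suc full-at)
                              (closed r~r′ (inj₂ refl) full-at full-at-suc)
    where
    full-at : P (r , t) ≡ true
    full-at = full (c≤t , <⇒≤ t<d)
    full-at-suc : P (r , suc t) ≡ true
    full-at-suc = full (m≤n⇒m≤1+n c≤t , t<d)

component-is-box : ∀ {M N P} → Bounded M N P → SquareClosed P → ∀ {v} → P v ≡ true →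
  ∃[ a ] ∃[ b ] ∃[ c ] ∃[ d ] (a ≤ b × c ≤ d × ∀ u → Reach² P v u ⇔ InBox a b c d u)
component-is-box {P = P} bounded sq-closed {i₀ , j₀} Pv =
  a , b , c , d , ≤-trans (proj₁ i₀∈) (proj₂ i₀∈) , ≤-trans (proj₁ j₀∈) (proj₂ j₀∈) ,
  λ u → mk⇔ component⊆box (box-connected box⊆P (i₀∈ , j₀∈))
  where
  row-of-v : MaximalInterval (λ t → P (i₀ , t) ≡ true) j₀
  row-of-v = maximal-interval (λ t → P (i₀ , t) ≟ᵇ true) (proj₂ ∘ bounded) Pv
  open MaximalInterval row-of-v using ()
    renaming (lo to c; hi to d; k∈ to j₀∈; inside to row-inside; closed to row-closed)

  Full : ℕ → Set
  Full r = ∀ {t} → t ∈[ c , d ] → P (r , t) ≡ true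

  full-rows : MaximalInterval Full i₀
  full-rows = maximal-interval (λ r → all-in-interval? (λ t → P (r , t) ≟ᵇ true) c d)
    (λ full → proj₁ (bounded (full (≤-refl , ≤-trans (proj₁ j₀∈) (proj₂ j₀∈))))) row-inside
  open MaximalInterval full-rows using ()
    renaming (lo to a; hi to b; k∈ to i₀∈; inside to full-inside; closed to full-closed)

  box⊆P : ∀ {u} → InBox a b c d u → P u ≡ true
  box⊆P (r∈ , t∈) = full-inside r∈ t∈

  step-closed : ∀ {u w} → InBox a b c d u → Adjacent u w → P w ≡ true → InBox a b c d w
  step-closed (r∈ , t∈) (inj₁ (refl , t~t′)) Pw =
    r∈ , row-closed t∈ t~t′ (trans column-t′-constant Pw)
    where
    column-t′-constant : P (i₀ , _) ≡ P (_ , _)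
    column-t′-constant =
      row-constant (transpose-closed sq-closed) t~t′ (λ s∈ → box⊆P (s∈ , t∈)) i₀∈ r∈
  step-closed (r∈ , t∈) (inj₂ (refl , r~r′)) Pw =
    full-closed r∈ r~r′ (λ s∈ → trans (row-r′-constant s∈ t∈) Pw) , t∈
    where
    row-r′-constant : ∀ {s s′} → s ∈[ c , d ] → s′ ∈[ c , d ] → P (_ , s) ≡ P (_ , s′)
    row-r′-constant = row-constant sq-closed r~r′ (λ s∈ → box⊆P (r∈ , s∈))

  component⊆box : ∀ {u} → Reach² P (i₀ , j₀) u → InBox a b c d u
  component⊆box (here _)           = i₀∈ , j₀∈
  component⊆box (step v⇝u u~w Pw) = step-closed (component⊆box v⇝u) u~w Pw

module _ {m n : ℕ} where

  ⌊_⌋ : V m n → Point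
  ⌊ i , j ⌋ = toℕ i , toℕ j

  ⌊⌋-injective : ∀ {u w : V m n} → ⌊ u ⌋ ≡ ⌊ w ⌋ → u ≡ w
  ⌊⌋-injective e = cong₂ _,_ (toℕ-injective (cong proj₁ e)) (toℕ-injective (cong proj₂ e))

  adj⇒≢ : ∀ {u w : V m n} → Adj u w → u ≢ w
  adj⇒≢ u~w refl = adjacent⇒≢ u~w refl

  -- S as a subset of ℕ², empty off the grid.
  at : Subset m n → Point → Bool
  at S (r , t) with r <? m | t <? n
  ... | yes r<m | yes t<n = S (fromℕ< r<m , fromℕ< t<n)
  ... | _       | _       = false

  module _ (S : Subset m n) where

    at-⌊⌋ : ∀ u → at S ⌊ u ⌋ ≡ S u
    at-⌊⌋ (i , j) with toℕ i <? m | toℕ j <? n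
    ... | yes _ | yes _ = cong S (cong₂ _,_ (fromℕ<-toℕ i _) (fromℕ<-toℕ j _))
    ... | no i≮m | _     = contradiction (toℕ<n i) i≮m
    ... | yes _ | no j≮n = contradiction (toℕ<n j) j≮n

    at-true : ∀ {p} → at S p ≡ true → ∃[ u ] ⌊ u ⌋ ≡ p × S u ≡ true
    at-true {r , t} Sp with r <? m | t <? n
    ... | yes r<m | yes t<n =
      (fromℕ< r<m , fromℕ< t<n) , cong₂ _,_ (toℕ-fromℕ< r<m) (toℕ-fromℕ< t<n) , Sp

    at-bounded : Bounded m n (at S)
    at-bounded Sp with at-true Sp
    ... | (i , j) , refl , _ = toℕ<n i , toℕ<n j

    reach⇒reach² : ∀ {u w} → Reach S u w → Reach² (at S) ⌊ u ⌋ ⌊ w ⌋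
    reach⇒reach² (here Su)          = here (trans (at-⌊⌋ _) Su)
    reach⇒reach² (step u⇝w w~w′ Sw′) = step (reach⇒reach² u⇝w) w~w′ (trans (at-⌊⌋ _) Sw′)

    reach²⇒reach : ∀ {u p} → Reach² (at S) ⌊ u ⌋ p → ∃[ w ] ⌊ w ⌋ ≡ p × Reach S u w
    reach²⇒reach {u} (here Su) = u , refl , here (trans (sym (at-⌊⌋ u)) Su)
    reach²⇒reach (step u⇝q q~p Sp) with reach²⇒reach u⇝q | at-true Sp
    ... | w , refl , u⇝w | w′ , refl , Sw′ = w′ , refl , step u⇝w q~p Sw′

    reach⇔reach² : ∀ {u w} → Reach S u w ⇔ Reach² (at S) ⌊ u ⌋ ⌊ w ⌋
    reach⇔reach² = mk⇔ reach⇒reach² from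
      where
      from : ∀ {u w} → Reach² (at S) ⌊ u ⌋ ⌊ w ⌋ → Reach S u w
      from u⇝w with reach²⇒reach u⇝w
      ... | w′ , ⌊w′⌋≡⌊w⌋ , u⇝w′ = subst (Reach S _) (⌊⌋-injective ⌊w′⌋≡⌊w⌋) u⇝w′

module _ {m n : ℕ} {S : Subset m n} where

  convex-cycle : Convex S → (C : Cycle m n) → All (λ u → S u ≡ true) (Cycle.rest C) →
    S (Cycle.start C) ≡ true
  convex-cycle convex C rest⊆S with S (Cycle.start C) in Sv
  ... | true  = refl
  ... | false = trans (sym Sv) (Equivalence.to (convex _) (inj₂ (C , here refl , Sv , only-start)))
    where
    only-start : ∀ u → u ∈ verts C → S u ≡ false → u ≡ Cycle.start C
    only-start u (here u≡v) _ = u≡v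
    only-start u (there u∈rest) Su with () ← trans (sym Su) (All.lookup rest⊆S u∈rest)

  fourth-corner : Convex S → ∀ {w x y z} → Adj w x → Adj x y → Adj y z → Adj z w →
    w ≢ y → x ≢ z → S x ≡ true → S y ≡ true → S z ≡ true → S w ≡ true
  fourth-corner convex w~x x~y y~z z~w w≢y x≢z Sx Sy Sz =
    convex-cycle convex square (Sx ∷ Sy ∷ Sz ∷ [])
    where
    square : Cycle m n
    square = mkCycle _ (_ ∷ _ ∷ _ ∷ []) (s≤s (s≤s z≤n))
      ((adj⇒≢ w~x ∷ w≢y ∷ (adj⇒≢ z~w ∘ sym) ∷ []) ∷ (adj⇒≢ x~y ∷ x≢z ∷ []) ∷
       (adj⇒≢ y~z ∷ []) ∷ [] ∷ [])
      (w~x ∷ x~y ∷ y~z ∷ z~w ∷ [-])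

  square-closed : Convex S → SquareClosed (at S)
  square-closed convex r~r′ t~t′ Sx Sy Sz with at-true S Sx | at-true S Sz
  ... | (i , j′) , refl , Sx′ | (i′ , j) , refl , Sz′ =
    trans (at-⌊⌋ S (i′ , j′))
      (fourth-corner convex (inj₂ (refl , ~-sym r~r′)) (inj₁ (refl , ~-sym t~t′))
                            (inj₂ (refl , r~r′)) (inj₁ (refl , t~t′))
        (~⇒≢ r~r′ ∘ sym ∘ cong (toℕ ∘ proj₁)) (~⇒≢ r~r′ ∘ cong (toℕ ∘ proj₁))
        Sx′ (trans (sym (at-⌊⌋ S (i , j))) Sy) Sz′)

  convex⇒boxed : Convex S → Boxed S
  convex⇒boxed convex v Sv
    with component-is-box (at-bounded S) (square-closed convex) (trans (at-⌊⌋ S v) Sv)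
  ... | a , b , c , d , a≤b , c≤d , component = a , b , c , d , a≤b , c≤d ,
    λ u → ⇔-trans (reach⇔reach² S) (component ⌊ u ⌋)

module _ {A : Set} {R : A → A → Set} where

  linked-split : ∀ xs {y ys} →
    Linked R (xs ++ y ∷ ys) → Linked R (xs ++ [ y ]) × Linked R (y ∷ ys)
  linked-split []               ys↗         = [-] , ys↗
  linked-split (x ∷ [])         (x~y ∷ ys↗) = (x~y ∷ [-]) , ys↗
  linked-split (x ∷ x′ ∷ xs)   (x~x′ ∷ ↗)  = map₁ (x~x′ ∷_) (linked-split (x′ ∷ xs) ↗)

  linked-join : ∀ xs {y ys} →
    Linked R (xs ++ [ y ]) → Linked R (y ∷ ys) → Linked R (xs ++ y ∷ ys)
  linked-join []             _                 ys↗ = ys↗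
  linked-join (x ∷ [])       (x~y ∷ [-])       ys↗ = x~y ∷ ys↗
  linked-join (x ∷ x′ ∷ xs) (x~x′ ∷ xs↗)     ys↗ = x~x′ ∷ linked-join (x′ ∷ xs) xs↗ ys↗

  linked-rotate : ∀ {x y} xs ys →
    Linked R (x ∷ xs ++ y ∷ ys ++ [ x ]) → Linked R (y ∷ ys ++ x ∷ xs ++ [ y ])
  linked-rotate {x} {y} xs ys closed with linked-split (x ∷ xs) closed
  ... | x⋯y , y⋯x = linked-join (y ∷ ys) y⋯x x⋯y

module _ {m n : ℕ} where

  rotate : (C : Cycle m n) → ∀ {v} → v ∈ verts C →
    Σ[ C′ ∈ Cycle m n ] Cycle.start C′ ≡ v × verts C′ ↭ verts C
  rotate C (here refl) = C , refl , ↭-refl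
  rotate (mkCycle s rest long distinct walk) {v} (there v∈rest) with ∈-∃++ v∈rest
  ... | pre , post , refl = mkCycle v (post ++ s ∷ pre) long′ distinct′ walk′ , refl , σ
    where
    σ : (v ∷ post) ++ (s ∷ pre) ↭ (s ∷ pre) ++ (v ∷ post)
    σ = ++-comm (v ∷ post) (s ∷ pre)
    long′ : 2 ≤ length (post ++ s ∷ pre)
    long′ = subst (2 ≤_) (suc-injective (sym (↭-length σ))) long
    distinct′ : Unique (v ∷ post ++ s ∷ pre)
    distinct′ = Unique-resp-↭ (setoid _) (↭⇒↭ₛ (↭-sym σ)) distinct
    walk′ : Linked Adj ((v ∷ post ++ s ∷ pre) ++ [ v ])
    walk′ = subst (Linked Adj ∘ (v ∷_)) (sym (++-assoc post (s ∷ pre) [ v ]))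
              (linked-rotate pre post (subst (Linked Adj ∘ (s ∷_)) (++-assoc pre (v ∷ post) [ s ]) walk))

  module _ {S : Subset m n} where

    reach-source : ∀ {u w} → Reach S u w → S u ≡ true
    reach-source (here Su)       = Su
    reach-source (step u⇝w _ _) = reach-source u⇝w

    reach-target : ∀ {u w} → Reach S u w → S w ≡ true
    reach-target (here Sw)     = Sw
    reach-target (step _ _ Sw) = Sw

    reach-to-last : ∀ {a x v} zs → Reach S a x → Linked Adj (x ∷ zs ++ [ v ]) →
      All (λ u → S u ≡ true) zs → ∃[ y ] y ∈ x ∷ zs × Adj y v × Reach S a y
    reach-to-last []       a⇝x (x~v ∷ [-]) []          = _ , here refl , x~v , a⇝x
    reach-to-last (z ∷ zs) a⇝x (x~z ∷ walk) (Sz ∷ S-zs)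
      with reach-to-last zs (step a⇝x x~z Sz) walk S-zs
    ... | y , y∈ , y~v , a⇝y = y , there y∈ , y~v , a⇝y

    Detour : V m n → Set
    Detour v = ∃₂ λ x y → x ≢ y × Adj x v × Adj y v × Reach S x y

    detour-from-start : ∀ {v rest} → Unique (v ∷ rest) → 2 ≤ length rest →
      Linked Adj (v ∷ rest ++ [ v ]) → All (λ u → S u ≡ true) rest → Detour v
    detour-from-start {rest = x ∷ z ∷ zs} (_ ∷ x∉ ∷ _) _ (v~x ∷ x~z ∷ walk) (Sx ∷ Sz ∷ S-zs)
      with reach-to-last zs (step (here Sx) x~z Sz) walk S-zs
    ... | y , y∈ , y~v , x⇝y = x , y , All.lookup x∉ y∈ , adjacent-sym v~x , y~v , x⇝y
    detour-from-start {rest = _ ∷ []} _ (s≤s ()) _ _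

    cycle-detour : (C : Cycle m n) → ∀ {v} → v ∈ verts C →
      (∀ u → u ∈ verts C → S u ≡ false → u ≡ v) → Detour v
    cycle-detour C v∈C only-v with rotate C v∈C
    ... | mkCycle _ rest long distinct@(v∉ ∷ _) walk , refl , σ =
      detour-from-start distinct long walk (All.tabulate rest⊆S)
      where
      rest⊆S : ∀ {u} → u ∈ rest → S u ≡ true
      rest⊆S {u} u∈ = ¬-not λ Su → All.lookup v∉ u∈ (sym (only-v u (∈-resp-↭ σ (there u∈)) Su))

    boxed⇒convex : Boxed S → Convex S
    boxed⇒convex boxed v = mk⇔ in-hull inj₁
      where
      in-hull : InIcc S v → S v ≡ true
      in-hull (inj₁ Sv) = Sv
      in-hull (inj₂ (C , v∈C , Sv , only-v)) with cycle-detour C v∈C only-v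
      ... | x , y , x≢y , x~v , y~v , x⇝y with boxed x (reach-source x⇝y)
      ...   | _ , _ , _ , _ , _ , _ , component =
        contradiction (⌊⌋-injective (box-neighbour-unique x∈ y∈ v∉ x~v y~v)) x≢y
        where
        x∈ : InRect _ _ _ _ x
        x∈ = Equivalence.to (component x) (here (reach-source x⇝y))
        y∈ : InRect _ _ _ _ y
        y∈ = Equivalence.to (component y) x⇝y
        v∉ : ¬ InRect _ _ _ _ v
        v∉ v∈ = contradiction (trans (sym Sv) (reach-target (Equivalence.from (component v) v∈))) λ ()

proposition6 : (m n : ℕ) → 1 ≤ m → 1 ≤ n →
    (S : Subset m n) → Convex S ⇔ Boxed S
proposition6 m n _ _ S = mk⇔ convex⇒boxed boxed⇒convex
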